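{- Let $n\in\mathbb{N}$ and let $G=C_2\oplus C_{2n}$. Then the Harborth constant of $G$ satisfies \[ \mathsf{g}(C_2\oplus C_{2n})=\begin{cases} 2n+3 & \text{if $n$ is odd},\\ 2n+2 & \text{if $n$ is even}.\end{cases} \]
   Context: For a finite abelian group $G$ (written additively), $\exp(G)$ denotes its exponent and $C_m$ a cyclic group of order $m$. The Harborth constant $\mathsf{g}(G)$ is the smallest $\ell\in\mathbb{N}$ such that every subset $S\subseteq G$ with $|S|\ge \ell$ contains a subset of exactly $\exp(G)$ elements whose sum is $0$. (If no subset of $G$ has cardinality $\ell$, the condition is vacuously satisfied.) -}

module Defs where

open import Data.Nat using (ℕ; zero; suc; _+_; _*_; _≤_; _<_; NonZero)
open import Data.Nat.Properties using (m*n≢0)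
open import Data.Nat.DivMod using (_mod_)
open import Data.Fin using (Fin; toℕ)
open import Data.List using (List; []; _∷_; length; foldr)
open import Data.List.Relation.Unary.Unique.Propositional using (Unique)
open import Data.List.Relation.Unary.All using (All)
open import Data.List.Membership.Propositional using (_∈_)
open import Data.Product using (_×_; _,_; ∃-syntax)
open import Relation.Binary.PropositionalEquality using (_≡_)
open import Relation.Nullary using (¬_)

-- An abelian group given by its carrier, addition and zero
-- (only the operations are needed to state the Harborth constant).
record AbGroupOps : Set₁ where
  field
    Carrier : Set
    _⊕_     : Carrier → Carrier → Carrier
    𝟘       : Carrier

module _ (G : AbGroupOps) where
  open AbGroupOps G

  mul : ℕ → Carrier → Carrier
  mul zero    g = 𝟘
  mul (suc k) g = g ⊕ mul k g

  sumG : List Carrier → Carrier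
  sumG = foldr _⊕_ 𝟘

  IsExponent : ℕ → Set
  IsExponent e = (1 ≤ e) × (∀ g → mul e g ≡ 𝟘)
                 × (∀ e' → 1 ≤ e' → (∀ g → mul e' g ≡ 𝟘) → e ≤ e')

  -- Finite subsets of G are represented by duplicate-free lists; |S| = length S.
  -- HarborthProp e ℓ : every subset S with |S| ≥ ℓ contains a subset T with
  -- |T| = e and sum T = 0.
  HarborthProp : ℕ → ℕ → Set
  HarborthProp e ℓ = ∀ (S : List Carrier) → Unique S → ℓ ≤ length S →
    ∃[ T ] (Unique T × All (_∈ S) T × length T ≡ e × sumG T ≡ 𝟘)

  IsHarborthConstant : ℕ → ℕ → Set
  IsHarborthConstant e g = HarborthProp e g × (∀ ℓ → ℓ < g → ¬ HarborthProp e ℓ)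

_+ₘ_ : ∀ {m} .{{_ : NonZero m}} → Fin m → Fin m → Fin m
_+ₘ_ {m} a b = (toℕ a + toℕ b) mod m

0ₘ : ∀ {m} .{{_ : NonZero m}} → Fin m
0ₘ {m} = 0 mod m

DirectSumCyclic : (a b : ℕ) .{{_ : NonZero a}} .{{_ : NonZero b}} → AbGroupOps
DirectSumCyclic a b = record
  { Carrier = Fin a × Fin b
  ; _⊕_ = λ { (x₁ , y₁) (x₂ , y₂) → (x₁ +ₘ x₂) , (y₁ +ₘ y₂) }
  ; 𝟘 = 0ₘ , 0ₘ
  }

C2⊕C2n : (n : ℕ) .{{_ : NonZero n}} → AbGroupOps
C2⊕C2n n = DirectSumCyclic 2 (2 * n) {{_}} {{m*n≢0 2 n}}

module Submission where

-- Write G = C₂ ⊕ C₂ₙ, so exp(G) = 2n, and split G into the layers {ε} × C₂ₙ.  For a set S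
-- of 2n + 2 elements with sum σ, the 2n-subsets of S with sum 0 are exactly the complements
-- of pairs x ≠ y in S with x + y = σ.  Suppose there is no such pair.  If σ has odd first
-- coordinate, (0, b) ↦ b, (1, b) ↦ σ₂ − b is injective on S, so |S| ≤ 2n: impossible.
-- Otherwise every layer of S meets each orbit {b, σ₂ − b} of C₂ₙ at most once, and there are at
-- most n + 1 orbits, so both layers have exactly n + 1 elements and σ has first coordinate n + 1,
-- which must then be even.  This rules out n even, giving g ≤ 2n + 2.  For any n, a set of
-- 2n + 3 elements has a layer with between 1 and n + 1 elements; deleting one of them leaves
-- 2n + 2 elements with an unbalanced layer, so g ≤ 2n + 3.  Conversely, every 2n-subset of
-- ({0} × C₂ₙ) ∪ {(1, 0)} has sum (1, ·) or (0, n), and for odd n the set {0, 1} × {0, …, n}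
-- has sum 0, so a zero-sum 2n-subset would omit two distinct elements adding up to 0.

open import Defs
open import Data.Nat
  using (ℕ; zero; suc; _+_; _*_; _%_; _/_; _∸_; _≤_; _≰_; _<_; _⊓_; NonZero; z≤n; s≤s; s≤s⁻¹; _≤?_; _<?_; _≟_; >-nonZero)
open import Data.Nat.Properties
open import Data.Nat.DivMod
open import Data.Nat.Divisibility using (∣⇒≤; m%n≡0⇒n∣m)
open import Data.Nat.ListAction using (sum)
open import Data.Nat.ListAction.Properties using (sum-++; sum-↭)
open import Data.Nat.Tactic.RingSolver using (solve-∀)
open import Data.Fin using (Fin; toℕ)
import Data.Fin as Fin
open import Data.Fin.Properties using (toℕ-injective; toℕ-fromℕ<; toℕ<n)
open import Data.Fin.Patterns using (0F; 1F)
open import Data.List using (List; []; _∷_; length; _++_; filter; take; downFrom; map)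
open import Data.List.Properties using (length-++; length-take; length-map; length-downFrom; map-++)
open import Data.List.Relation.Unary.Unique.Propositional using (Unique)
import Data.List.Relation.Unary.Unique.Propositional.Properties as Unique
open import Data.List.Relation.Unary.AllPairs using ([]; _∷_)
open import Data.List.Relation.Unary.All as All using (All; []; _∷_)
open import Data.List.Relation.Unary.All.Properties using (map⁺)
open import Data.List.Relation.Unary.Any using (here; there; any?)
open import Data.List.Membership.Propositional using (_∈_; find; lose)
open import Data.List.Membership.Propositional.Properties using (∈-∃++; ∈-++⁻; ∈-++⁺ˡ; ∈-++⁺ʳ; ∈-downFrom⁺; ∈-downFrom⁻; ∈-filter⁻; ∈-map⁻)
open import Data.List.Relation.Binary.Permutation.Propositional using (_↭_; prep; ↭-refl; ↭-trans; ↭-sym; ↭⇒↭ₛ)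
open import Data.List.Relation.Binary.Permutation.Propositional.Properties using (shift; ↭-length; ∈-resp-↭; filter-↭)
import Data.List.Relation.Binary.Permutation.Propositional.Properties as Perm
import Data.List.Relation.Binary.Permutation.Setoid.Properties as PermSetoid
open import Data.Product using (∃-syntax; _×_; _,_; proj₁; proj₂)
open import Data.Product.Properties using (≡-dec)
open import Data.Sum using (_⊎_; inj₁; inj₂)
open import Data.Empty using (⊥; ⊥-elim)
open import Function using (_∘_)
open import Relation.Nullary using (¬_; Dec; yes; no)
open import Relation.Nullary.Decidable using (_×-dec_; ¬?; decidable-stable)
open import Relation.Binary.PropositionalEquality
open import Relation.Binary.PropositionalEquality.Properties using (setoid)

-- Finite sets as duplicate-free lists

module _ {A : Set} where

  ⊆-complement : (T : List A) {S : List A} → Unique T → All (_∈ S) T → ∃[ R ] (S ↭ T ++ R)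
  ⊆-complement [] {S} _ _ = S , ↭-refl
  ⊆-complement (t ∷ T) (t∉T ∷ T!) (t∈S ∷ T⊆S) with ∈-∃++ t∈S
  ... | xs , ys , refl with ⊆-complement T T! (All.zipWith drop-t (t∉T , T⊆S))
    where
      drop-t : ∀ {x} → t ≢ x × x ∈ xs ++ t ∷ ys → x ∈ xs ++ ys
      drop-t (t≢x , x∈) with ∈-++⁻ xs x∈
      ... | inj₁ x∈xs = ∈-++⁺ˡ x∈xs
      ... | inj₂ (here x≡t) = ⊥-elim (t≢x (sym x≡t))
      ... | inj₂ (there x∈ys) = ∈-++⁺ʳ xs x∈ys
  ... | R , p = R , ↭-trans (shift t xs ys) (prep t p)

  module _ {S : List A} (T : List A) {R : List A} (S↭T++R : S ↭ T ++ R) where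

    length-complement : length S ≡ length T + length R
    length-complement = trans (↭-length S↭T++R) (length-++ T)

    complement-⊆ : All (_∈ S) R
    complement-⊆ = All.tabulate (λ x∈R → ∈-resp-↭ (↭-sym S↭T++R) (∈-++⁺ʳ T x∈R))

    complement-unique : Unique S → Unique R
    complement-unique S! = drop T (PermSetoid.Unique-resp-↭ (setoid A) (↭⇒↭ₛ S↭T++R) S!)
      where
        drop : ∀ T → Unique (T ++ R) → Unique R
        drop [] T++R! = T++R!
        drop (_ ∷ T) (_ ∷ T++R!) = drop T T++R!

  nonempty-∈ : ∀ {S : List A} → 0 < length S → ∃[ x ] x ∈ S
  nonempty-∈ {x ∷ _} _ = x , here refl

  ⊆-trans : {T S U : List A} → All (_∈ S) T → All (_∈ U) S → All (_∈ U) T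
  ⊆-trans T⊆S S⊆U = All.map (All.lookup S⊆U) T⊆S

  take-⊆ : ∀ j (S : List A) → All (_∈ S) (take j S)
  take-⊆ zero S = []
  take-⊆ (suc j) [] = []
  take-⊆ (suc j) (x ∷ S) = here refl ∷ All.map there (take-⊆ j S)

  length-≤-of-⊆ : {T S : List A} → Unique T → All (_∈ S) T → length T ≤ length S
  length-≤-of-⊆ {T} T! T⊆S with ⊆-complement T T! T⊆S
  ... | R , p = ≤-trans (m≤m+n (length T) (length R)) (≤-reflexive (sym (length-complement T p)))

  Unique-map⁺-on : {B : Set} (f : A → B) {S : List A} → Unique S →
    (∀ {x y} → x ∈ S → y ∈ S → f x ≡ f y → x ≡ y) → Unique (map f S)
  Unique-map⁺-on f [] _ = []
  Unique-map⁺-on f (x∉S ∷ S!) inj =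
    map⁺ (All.tabulate (λ y∈S fx≡fy → All.lookup x∉S y∈S (inj (here refl) (there y∈S) fx≡fy)))
    ∷ Unique-map⁺-on f S! (λ x∈ y∈ → inj (there x∈) (there y∈))

length-≤-of-key : {A : Set} (f : A → ℕ) (k : ℕ) {S : List A} → Unique S →
  (∀ {x y} → x ∈ S → y ∈ S → f x ≡ f y → x ≡ y) → (∀ {x} → x ∈ S → f x < k) → length S ≤ k
length-≤-of-key f k {S} S! inj bounded = begin
  length S                ≡⟨ length-map f S ⟨
  length (map f S)        ≤⟨ length-≤-of-⊆ (Unique-map⁺-on f S! inj) (map⁺ (All.tabulate (∈-downFrom⁺ ∘ bounded))) ⟩
  length (downFrom k)     ≡⟨ length-downFrom k ⟩
  k                       ∎
  where open ≤-Reasoning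

-- Congruences modulo d

module _ {d : ℕ} .{{_ : NonZero d}} where

  toℕ-mod : ∀ a → toℕ (a mod d) ≡ a % d
  toℕ-mod a = toℕ-fromℕ< (m%n<n a d)

  %≡⇒mod≡ : ∀ a b → a % d ≡ b % d → a mod d ≡ b mod d
  %≡⇒mod≡ a b a≡b = toℕ-injective (trans (toℕ-mod a) (trans a≡b (sym (toℕ-mod b))))

  mod≡⇒%≡ : ∀ a b → a mod d ≡ b mod d → a % d ≡ b % d
  mod≡⇒%≡ a b a≡b = trans (sym (toℕ-mod a)) (trans (cong toℕ a≡b) (toℕ-mod b))

  %≡⇒≡ : ∀ {a b} → a < d → b < d → a % d ≡ b % d → a ≡ b
  %≡⇒≡ a<d b<d a≡b = trans (sym (m<n⇒m%n≡m a<d)) (trans a≡b (m<n⇒m%n≡m b<d))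

  %-absorbʳ-+ : ∀ a b → (a + b % d) % d ≡ (a + b) % d
  %-absorbʳ-+ a b = begin
    (a + b % d) % d          ≡⟨ %-distribˡ-+ a (b % d) d ⟩
    (a % d + b % d % d) % d  ≡⟨ cong (λ z → (a % d + z) % d) (m%n%n≡m%n b d) ⟩
    (a % d + b % d) % d      ≡⟨ %-distribˡ-+ a b d ⟨
    (a + b) % d              ∎
    where open ≡-Reasoning

  %-congˡ-+ : ∀ a b c → a % d ≡ b % d → (a + c) % d ≡ (b + c) % d
  %-congˡ-+ a b c a≡b = begin
    (a + c) % d          ≡⟨ %-distribˡ-+ a c d ⟩
    (a % d + c % d) % d  ≡⟨ cong (λ z → (z + c % d) % d) a≡b ⟩
    (b % d + c % d) % d  ≡⟨ %-distribˡ-+ b c d ⟨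
    (b + c) % d          ∎
    where open ≡-Reasoning

  mod-absorbʳ-+ : ∀ a b → (a + toℕ (b mod d)) mod d ≡ (a + b) mod d
  mod-absorbʳ-+ a b = %≡⇒mod≡ (a + toℕ (b mod d)) (a + b)
    (trans (cong (λ z → (a + z) % d) (toℕ-mod b)) (%-absorbʳ-+ a b))

%-cancelˡ-+ : ∀ {d} .{{_ : NonZero d}} a {b c} → (a + b) % d ≡ (a + c) % d → b % d ≡ c % d
%-cancelˡ-+ {suc d'} a {b} {c} a+b≡a+c = begin
  b % d                      ≡⟨ [m+kn]%n≡m%n b a d ⟨
  (b + a * d) % d            ≡⟨ cong (_% d) (shuffle a b d') ⟩
  ((a + b) + a * d') % d     ≡⟨ %-congˡ-+ (a + b) (a + c) (a * d') a+b≡a+c ⟩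
  ((a + c) + a * d') % d     ≡⟨ cong (_% d) (shuffle a c d') ⟨
  (c + a * d) % d            ≡⟨ [m+kn]%n≡m%n c a d ⟩
  c % d                      ∎
  where
    open ≡-Reasoning
    d = suc d'
    shuffle : ∀ a b d' → b + a * suc d' ≡ (a + b) + a * d'
    shuffle = solve-∀

%-cancelʳ-+-< : ∀ {d} .{{_ : NonZero d}} {a b} c → a < d → b < d → (a + c) % d ≡ (b + c) % d → a ≡ b
%-cancelʳ-+-< {d} {a} {b} c a<d b<d a+c≡b+c = %≡⇒≡ a<d b<d (%-cancelˡ-+ c (begin
  (c + a) % d  ≡⟨ cong (_% d) (+-comm c a) ⟩
  (a + c) % d  ≡⟨ a+c≡b+c ⟩
  (b + c) % d  ≡⟨ cong (_% d) (+-comm b c) ⟩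
  (c + b) % d  ∎))
  where open ≡-Reasoning

m%2≡0⊎m%2≡1 : ∀ a → a % 2 ≡ 0 ⊎ a % 2 ≡ 1
m%2≡0⊎m%2≡1 a with a % 2 | m%n<n a 2
... | 0 | _ = inj₁ refl
... | 1 | _ = inj₂ refl
... | suc (suc _) | s≤s (s≤s ())

m+n≡o+o⇒m≡o : ∀ {a b c} → a ≤ c → b ≤ c → a + b ≡ c + c → a ≡ c
m+n≡o+o⇒m≡o {a} {b} {c} a≤c b≤c a+b≡c+c = ≤-antisym a≤c (+-cancelʳ-≤ c c a (begin
  c + c  ≡⟨ a+b≡c+c ⟨
  a + b  ≤⟨ +-monoʳ-≤ a b≤c ⟩
  a + c  ∎))
  where open ≤-Reasoning

sum-map-++ : {A : Set} (f : A → ℕ) (T R : List A) → sum (map f (T ++ R)) ≡ sum (map f T) + sum (map f R)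
sum-map-++ f T R = trans (cong sum (map-++ f T R)) (sum-++ (map f T) (map f R))

sum-map-pair : {A : Set} (f : A → ℕ) (x y : A) → sum (map f (x ∷ y ∷ [])) ≡ f x + f y
sum-map-pair f x y = cong (f x +_) (+-identityʳ (f y))

sum-map-complement : {A : Set} (f : A → ℕ) {S : List A} (T : List A) {R : List A} → S ↭ T ++ R →
  sum (map f S) ≡ sum (map f T) + sum (map f R)
sum-map-complement f T {R} S↭T++R = trans (sum-↭ (Perm.map⁺ f S↭T++R)) (sum-map-++ f T R)

module _ {A : Set} (f : A → ℕ) {d : ℕ} .{{_ : NonZero d}}
         {S : List A} (T : List A) {R : List A} (S↭T++R : S ↭ T ++ R) where

  complement-of-zero-sum : sum (map f T) % d ≡ 0 % d → sum (map f R) % d ≡ sum (map f S) % d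
  complement-of-zero-sum ΣT≡0 = begin
    sum (map f R) % d                    ≡⟨ %-congˡ-+ (sum (map f T)) 0 (sum (map f R)) ΣT≡0 ⟨
    (sum (map f T) + sum (map f R)) % d  ≡⟨ cong (_% d) (sum-map-complement f T S↭T++R) ⟨
    sum (map f S) % d                    ∎
    where open ≡-Reasoning

  complement-of-full-sum : sum (map f T) % d ≡ sum (map f S) % d → sum (map f R) % d ≡ 0 % d
  complement-of-full-sum ΣT≡ΣS = sym (%-cancelˡ-+ (sum (map f T)) (begin
    (sum (map f T) + 0) % d              ≡⟨ cong (_% d) (+-identityʳ (sum (map f T))) ⟩
    sum (map f T) % d                    ≡⟨ ΣT≡ΣS ⟩
    sum (map f S) % d                    ≡⟨ cong (_% d) (sum-map-complement f T S↭T++R) ⟩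
    (sum (map f T) + sum (map f R)) % d  ∎))
    where open ≡-Reasoning

module _ (G : AbGroupOps) (e : ℕ) where
  open AbGroupOps G

  HasZeroSumSubset : List Carrier → Set
  HasZeroSumSubset S = ∃[ T ] (Unique T × All (_∈ S) T × length T ≡ e × sumG G T ≡ 𝟘)

  HasZeroSumSubset-mono : ∀ {S S'} → All (_∈ S) S' → HasZeroSumSubset S' → HasZeroSumSubset S
  HasZeroSumSubset-mono S'⊆S (T , T! , T⊆S' , |T| , ΣT) = T , T! , ⊆-trans T⊆S' S'⊆S , |T| , ΣT

  IsHarborthConstant-intro : ∀ {g} ℓ → g ≡ suc ℓ →
    (∀ {S} → Unique S → length S ≡ g → HasZeroSumSubset S) →
    (S₀ : List Carrier) → Unique S₀ → length S₀ ≡ ℓ → ¬ HasZeroSumSubset S₀ →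
    IsHarborthConstant G e g
  IsHarborthConstant-intro ℓ refl upper S₀ S₀! |S₀| S₀-free = harborth , below
    where
      harborth : HarborthProp G e (suc ℓ)
      harborth S S! ℓ<|S| = HasZeroSumSubset-mono (take-⊆ (suc ℓ) S)
        (upper (Unique.take⁺ (suc ℓ) S!) (trans (length-take (suc ℓ) S) (m≤n⇒m⊓n≡m ℓ<|S|)))
      below : ∀ ℓ' → ℓ' < suc ℓ → ¬ HarborthProp G e ℓ'
      below ℓ' ℓ'<1+ℓ H = S₀-free (H S₀ S₀! (≤-trans (s≤s⁻¹ ℓ'<1+ℓ) (≤-reflexive (sym |S₀|))))

-- The group C₂ ⊕ C₂ₙ

module C₂⊕C₂ₙ (k : ℕ) where

  n m : ℕ
  n = suc k
  m = 2 * n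

  n<m : n < m
  n<m = m<m+n n {n + 0} (s≤s z≤n)

  E : Set
  E = Fin 2 × Fin m

  G : AbGroupOps
  G = C2⊕C2n n

  π₁ π₂ : E → ℕ
  π₁ x = toℕ (proj₁ x)
  π₂ x = toℕ (proj₂ x)

  Σ₁ Σ₂ : List E → ℕ
  Σ₁ S = sum (map π₁ S)
  Σ₂ S = sum (map π₂ S)

  sumG-coords : ∀ S → sumG G S ≡ (Σ₁ S mod 2 , Σ₂ S mod m)
  sumG-coords [] = refl
  sumG-coords (x ∷ S) rewrite sumG-coords S =
    cong₂ _,_ (mod-absorbʳ-+ (π₁ x) (Σ₁ S)) (mod-absorbʳ-+ (π₂ x) (Σ₂ S))

  mul-coords : ∀ j x → mul G j x ≡ ((j * π₁ x) mod 2 , (j * π₂ x) mod m)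
  mul-coords zero x = refl
  mul-coords (suc j) x rewrite mul-coords j x =
    cong₂ _,_ (mod-absorbʳ-+ (π₁ x) (j * π₁ x)) (mod-absorbʳ-+ (π₂ x) (j * π₂ x))

  sumG≡𝟘⇒ : ∀ S → sumG G S ≡ AbGroupOps.𝟘 G → Σ₁ S % 2 ≡ 0 × Σ₂ S % m ≡ 0
  sumG≡𝟘⇒ S ΣS≡0 = mod≡⇒%≡ (Σ₁ S) 0 (cong proj₁ coords≡0) , mod≡⇒%≡ (Σ₂ S) 0 (cong proj₂ coords≡0)
    where coords≡0 = trans (sym (sumG-coords S)) ΣS≡0

  ⇒sumG≡𝟘 : ∀ S → Σ₁ S % 2 ≡ 0 → Σ₂ S % m ≡ 0 → sumG G S ≡ AbGroupOps.𝟘 G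
  ⇒sumG≡𝟘 S Σ₁≡0 Σ₂≡0 =
    trans (sumG-coords S) (cong₂ _,_ (%≡⇒mod≡ (Σ₁ S) 0 Σ₁≡0) (%≡⇒mod≡ (Σ₂ S) 0 Σ₂≡0))

  exponent≡m : ∀ {e} → IsExponent G e → e ≡ m
  exponent≡m {e} (1≤e , e-kills , e-least) = ≤-antisym (e-least m (s≤s z≤n) m-kills) m≤e
    where
      m-kills : ∀ x → mul G m x ≡ AbGroupOps.𝟘 G
      m-kills x rewrite mul-coords m x = cong₂ _,_
        (%≡⇒mod≡ (m * π₁ x) 0 (trans (cong (_% 2) (trans (*-assoc 2 n (π₁ x)) (*-comm 2 (n * π₁ x))))
                                     (m*n%n≡0 (n * π₁ x) 2)))
        (%≡⇒mod≡ (m * π₂ x) 0 (trans (cong (_% m) (*-comm m (π₂ x))) (m*n%n≡0 (π₂ x) m)))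
      generator : E
      generator = 0F , (1 mod m)
      π₂-generator : π₂ generator ≡ 1
      π₂-generator = trans (toℕ-mod 1) (m<n⇒m%n≡m (≤-trans (s≤s (s≤s z≤n)) n<m))
      e%m≡0 : e % m ≡ 0
      e%m≡0 = begin
        e % m                   ≡⟨ cong (_% m) (*-identityʳ e) ⟨
        (e * 1) % m             ≡⟨ cong (λ z → (e * z) % m) π₂-generator ⟨
        (e * π₂ generator) % m  ≡⟨ mod≡⇒%≡ (e * π₂ generator) 0
                                     (cong proj₂ (trans (sym (mul-coords e generator)) (e-kills generator))) ⟩
        0                       ∎
        where open ≡-Reasoning
      m≤e : m ≤ e
      m≤e = ∣⇒≤ {{>-nonZero 1≤e}} (m%n≡0⇒n∣m e m e%m≡0)

  layer : Fin 2 → List E → List E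
  layer a = filter (λ x → proj₁ x Fin.≟ a)

  length-layers : ∀ S → length S ≡ length (layer 0F S) + length (layer 1F S)
  length-layers [] = refl
  length-layers ((0F , _) ∷ S) = cong suc (length-layers S)
  length-layers ((1F , _) ∷ S) = trans (cong suc (length-layers S)) (sym (+-suc _ _))

  Σ₁≡length-layer₁ : ∀ S → Σ₁ S ≡ length (layer 1F S)
  Σ₁≡length-layer₁ [] = refl
  Σ₁≡length-layer₁ ((0F , _) ∷ S) = Σ₁≡length-layer₁ S
  Σ₁≡length-layer₁ ((1F , _) ∷ S) = cong suc (Σ₁≡length-layer₁ S)

  length-layer-↭ : ∀ a {S S'} → S ↭ S' → length (layer a S) ≡ length (layer a S')
  length-layer-↭ a S↭S' = ↭-length (filter-↭ (λ x → proj₁ x Fin.≟ a) S↭S')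

  length-layer-∷ : ∀ {a} z S → proj₁ z ≡ a → length (layer a (z ∷ S)) ≡ suc (length (layer a S))
  length-layer-∷ z S refl with proj₁ z Fin.≟ proj₁ z
  ... | yes _ = refl
  ... | no z≢z = ⊥-elim (z≢z refl)

  ∈-layer⁻ : ∀ {a x} S → x ∈ layer a S → x ∈ S × proj₁ x ≡ a
  ∈-layer⁻ {a} S = ∈-filter⁻ (λ x → proj₁ x Fin.≟ a) {xs = S}

  _≟ᴱ_ : (x y : E) → Dec (x ≡ y)
  _≟ᴱ_ = ≡-dec Fin._≟_ Fin._≟_

  SumsTo : ℕ → ℕ → E → E → Set
  SumsTo c₁ c₂ x y = (π₁ x + π₁ y) % 2 ≡ c₁ % 2 × (π₂ x + π₂ y) % m ≡ c₂ % m

  PairFree : ℕ → ℕ → List E → Set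
  PairFree c₁ c₂ S = ∀ {x y} → x ∈ S → y ∈ S → x ≢ y → ¬ SumsTo c₁ c₂ x y

  pair-or-pairFree : ∀ c₁ c₂ S →
    (∃[ x ] ∃[ y ] (x ∈ S × y ∈ S × x ≢ y × SumsTo c₁ c₂ x y)) ⊎ PairFree c₁ c₂ S
  pair-or-pairFree c₁ c₂ S with any? (λ x → any? (λ y → ¬? (x ≟ᴱ y) ×-dec sumsTo? x y) S) S
    where
      sumsTo? : ∀ x y → Dec (SumsTo c₁ c₂ x y)
      sumsTo? x y = ((π₁ x + π₁ y) % 2 ≟ c₁ % 2) ×-dec ((π₂ x + π₂ y) % m ≟ c₂ % m)
  ... | yes found = let x , x∈S , found-y = find found ; y , y∈S , x≢y , x+y = find found-y
                    in inj₁ (x , y , x∈S , y∈S , x≢y , x+y)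
  ... | no none = inj₂ (λ x∈S y∈S x≢y x+y → none (lose x∈S (lose y∈S (x≢y , x+y))))

  reflect : ℕ → ℕ → ℕ
  reflect r u = (r + (m ∸ u)) % m

  +-reflect : ∀ r {u} → u ≤ m → (u + reflect r u) % m ≡ r % m
  +-reflect r {u} u≤m = begin
    (u + (r + (m ∸ u)) % m) % m  ≡⟨ %-absorbʳ-+ u (r + (m ∸ u)) ⟩
    (u + (r + (m ∸ u))) % m      ≡⟨ cong (_% m) (trans (x+[y+z]≡y+[x+z] u r (m ∸ u)) (cong (r +_) (m+[n∸m]≡n u≤m))) ⟩
    (r + m) % m                  ≡⟨ [m+n]%n≡m%n r m ⟩
    r % m                        ∎
    where
      open ≡-Reasoning
      x+[y+z]≡y+[x+z] : ∀ x y z → x + (y + z) ≡ y + (x + z)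
      x+[y+z]≡y+[x+z] = solve-∀

  reflect-injective : ∀ r {u u'} → u < m → u' < m → reflect r u ≡ reflect r u' → u ≡ u'
  reflect-injective r {u} {u'} u<m u'<m ru≡ru' = %-cancelʳ-+-< (reflect r u) u<m u'<m (begin
    (u + reflect r u) % m    ≡⟨ +-reflect r (<⇒≤ u<m) ⟩
    r % m                    ≡⟨ +-reflect r (<⇒≤ u'<m) ⟨
    (u' + reflect r u') % m  ≡⟨ cong (λ z → (u' + z) % m) ru≡ru' ⟨
    (u' + reflect r u) % m   ∎)
    where open ≡-Reasoning

  -- With c ≡ 2δ + r (mod m), r ≤ 1, translating by −δ turns the involution b ↦ c − b into
  -- u ↦ r − u, and min (u , r − u) is a representative of the orbit lying in {0, …, n}.
  module PairKey (c : ℕ) where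
    private
      δ r : ℕ
      δ = (c % m) / 2
      r = (c % m) % 2

      δ≤m : δ ≤ m
      δ≤m = ≤-trans (m/n≤m (c % m) 2) (<⇒≤ (m%n<n c m))

      translate : ℕ → ℕ
      translate b = (b + (m ∸ δ)) % m

      translate<m : ∀ b → translate b < m
      translate<m b = m%n<n (b + (m ∸ δ)) m

      translate-injective : ∀ {b b'} → b < m → b' < m → translate b ≡ translate b' → b ≡ b'
      translate-injective = %-cancelʳ-+-< (m ∸ δ)

      translate-pair : ∀ b b' → (translate b + translate b') % m ≡ r % m → (b + b') % m ≡ c % m
      translate-pair b b' tb+tb' = begin
        (b + b') % m                            ≡⟨ [m+kn]%n≡m%n (b + b') 2 m ⟨
        ((b + b') + 2 * m) % m                  ≡⟨ cong (λ z → ((b + b') + 2 * z) % m) (m∸n+n≡m δ≤m) ⟨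
        ((b + b') + 2 * ((m ∸ δ) + δ)) % m      ≡⟨ cong (_% m) (regroup b b' (m ∸ δ) δ) ⟩
        (((b + (m ∸ δ)) + (b' + (m ∸ δ))) + δ * 2) % m
          ≡⟨ %-congˡ-+ ((b + (m ∸ δ)) + (b' + (m ∸ δ))) r (δ * 2)
               (trans (%-distribˡ-+ (b + (m ∸ δ)) (b' + (m ∸ δ)) m) tb+tb') ⟩
        (r + δ * 2) % m                         ≡⟨ cong (_% m) (m≡m%n+[m/n]*n (c % m) 2) ⟨
        c % m % m                               ≡⟨ m%n%n≡m%n c m ⟩
        c % m                                   ∎
        where
          open ≡-Reasoning
          regroup : ∀ b b' s δ → (b + b') + 2 * (s + δ) ≡ ((b + s) + (b' + s)) + δ * 2
          regroup = solve-∀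

      reflect-pair : ∀ b b' → translate b ≡ reflect r (translate b') → (b + b') % m ≡ c % m
      reflect-pair b b' tb≡rtb' = translate-pair b b' (begin
        (translate b + translate b') % m              ≡⟨ cong (λ z → (z + translate b') % m) tb≡rtb' ⟩
        (reflect r (translate b') + translate b') % m ≡⟨ cong (_% m) (+-comm (reflect r (translate b')) (translate b')) ⟩
        (translate b' + reflect r (translate b')) % m ≡⟨ +-reflect r (<⇒≤ (translate<m b')) ⟩
        r % m                                         ∎)
        where open ≡-Reasoning

      m∸[1+n]≡k : m ∸ suc n ≡ k
      m∸[1+n]≡k = begin
        (k + suc (k + 0)) ∸ suc k  ≡⟨ cong (λ z → (k + suc z) ∸ suc k) (+-identityʳ k) ⟩
        (k + suc k) ∸ suc k        ≡⟨ m+n∸n≡m k (suc k) ⟩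
        k                          ∎
        where open ≡-Reasoning

    key : ℕ → ℕ
    key b = translate b ⊓ reflect r (translate b)

    key≤n : ∀ b → key b ≤ n
    key≤n b with translate b ≤? n
    ... | yes tb≤n = ≤-trans (m⊓n≤m (translate b) _) tb≤n
    ... | no tb≰n = begin
      key b                                ≤⟨ m⊓n≤n (translate b) _ ⟩
      (r + (m ∸ translate b)) % m          ≤⟨ m%n≤m (r + (m ∸ translate b)) m ⟩
      r + (m ∸ translate b)                ≤⟨ +-mono-≤ (s≤s⁻¹ (m%n<n (c % m) 2)) (∸-monoʳ-≤ m (≰⇒> tb≰n)) ⟩
      1 + (m ∸ suc n)                      ≡⟨ cong suc m∸[1+n]≡k ⟩
      n                                    ∎
      where open ≤-Reasoning

    key-injective : ∀ {b b'} → b < m → b' < m → key b ≡ key b' → b ≡ b' ⊎ (b + b') % m ≡ c % m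
    key-injective {b} {b'} b<m b'<m kb≡kb'
      with ⊓-sel (translate b) (reflect r (translate b)) | ⊓-sel (translate b') (reflect r (translate b'))
    ... | inj₁ kb≡tb | inj₁ kb'≡tb' =
      inj₁ (translate-injective b<m b'<m (trans (sym kb≡tb) (trans kb≡kb' kb'≡tb')))
    ... | inj₁ kb≡tb | inj₂ kb'≡rtb' =
      inj₂ (reflect-pair b b' (trans (sym kb≡tb) (trans kb≡kb' kb'≡rtb')))
    ... | inj₂ kb≡rtb | inj₁ kb'≡tb' =
      inj₂ (trans (cong (_% m) (+-comm b b')) (reflect-pair b' b (trans (sym kb'≡tb') (trans (sym kb≡kb') kb≡rtb))))
    ... | inj₂ kb≡rtb | inj₂ kb'≡rtb' =
      inj₁ (translate-injective b<m b'<m (reflect-injective r (translate<m b) (translate<m b')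
        (trans (sym kb≡rtb) (trans kb≡kb' kb'≡rtb'))))

  layer-bound : ∀ a c₁ c₂ {S} → Unique S → c₁ % 2 ≡ 0 → PairFree c₁ c₂ S → length (layer a S) ≤ suc n
  layer-bound a c₁ c₂ {S} S! c₁-even pairFree =
    length-≤-of-key (key ∘ π₂) (suc n) (Unique.filter⁺ (λ x → proj₁ x Fin.≟ a) S!) injective
      (λ {x} _ → s≤s (key≤n (π₂ x)))
    where
      open PairKey c₂
      doubled-even : ∀ (a : Fin 2) → (toℕ a + toℕ a) % 2 ≡ 0
      doubled-even 0F = refl
      doubled-even 1F = refl
      injective : ∀ {x y} → x ∈ layer a S → y ∈ layer a S → key (π₂ x) ≡ key (π₂ y) → x ≡ y
      injective {x} {y} x∈ y∈ kx≡ky with ∈-layer⁻ S x∈ | ∈-layer⁻ S y∈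
      ... | x∈S , x₁≡a | y∈S , y₁≡a with key-injective (toℕ<n (proj₂ x)) (toℕ<n (proj₂ y)) kx≡ky
      ... | inj₁ x₂≡y₂ = cong₂ _,_ (trans x₁≡a (sym y₁≡a)) (toℕ-injective x₂≡y₂)
      ... | inj₂ x₂+y₂ = decidable-stable (x ≟ᴱ y) (λ x≢y → pairFree x∈S y∈S x≢y (x₁+y₁ , x₂+y₂))
        where
          x₁+y₁ : (π₁ x + π₁ y) % 2 ≡ c₁ % 2
          x₁+y₁ rewrite x₁≡a | y₁≡a = trans (doubled-even a) (sym c₁-even)

  cross-bound : ∀ c₁ c₂ {S} → Unique S → c₁ % 2 ≡ 1 → PairFree c₁ c₂ S → length S ≤ m
  cross-bound c₁ c₂ {S} S! c₁-odd pairFree = length-≤-of-key fold m S! injective bounded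
    where
      fold : E → ℕ
      fold (0F , b) = toℕ b
      fold (1F , b) = reflect c₂ (toℕ b)
      cross-pair : ∀ (b b' : Fin m) → toℕ b ≡ reflect c₂ (toℕ b') → SumsTo c₁ c₂ (0F , b) (1F , b')
      cross-pair b b' b≡rb' = sym c₁-odd , (begin
        (toℕ b + toℕ b') % m                 ≡⟨ cong (λ z → (z + toℕ b') % m) b≡rb' ⟩
        (reflect c₂ (toℕ b') + toℕ b') % m   ≡⟨ cong (_% m) (+-comm (reflect c₂ (toℕ b')) (toℕ b')) ⟩
        (toℕ b' + reflect c₂ (toℕ b')) % m   ≡⟨ +-reflect c₂ (<⇒≤ (toℕ<n b')) ⟩
        c₂ % m                               ∎)
        where open ≡-Reasoning
      injective : ∀ {x y} → x ∈ S → y ∈ S → fold x ≡ fold y → x ≡ y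
      injective {0F , b} {0F , b'} _ _ b≡b' = cong (0F ,_) (toℕ-injective b≡b')
      injective {1F , b} {1F , b'} _ _ rb≡rb' =
        cong (1F ,_) (toℕ-injective (reflect-injective c₂ (toℕ<n b) (toℕ<n b') rb≡rb'))
      injective {0F , b} {1F , b'} x∈S y∈S b≡rb' = ⊥-elim (pairFree x∈S y∈S (λ ()) (cross-pair b b' b≡rb'))
      injective {1F , b} {0F , b'} x∈S y∈S rb≡b' = ⊥-elim (pairFree y∈S x∈S (λ ()) (cross-pair b' b (sym rb≡b')))
      bounded : ∀ {x} → x ∈ S → fold x < m
      bounded {0F , b} _ = toℕ<n b
      bounded {1F , b} _ = m%n<n (c₂ + (m ∸ toℕ b)) m

  ZeroSumSubset : List E → Set
  ZeroSumSubset = HasZeroSumSubset G m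

  pair-complement : ∀ {S x y} → Unique S → length S ≡ m + 2 → x ∈ S → y ∈ S → x ≢ y →
    SumsTo (Σ₁ S) (Σ₂ S) x y → ZeroSumSubset S
  pair-complement {S} {x} {y} S! |S| x∈S y∈S x≢y (x₁+y₁ , x₂+y₂)
    with ⊆-complement (x ∷ y ∷ []) ((x≢y ∷ []) ∷ [] ∷ []) (x∈S ∷ y∈S ∷ [])
  ... | R , S↭xy++R =
    R , complement-unique xy S↭xy++R S! , complement-⊆ xy S↭xy++R , |R| ,
    ⇒sumG≡𝟘 R (complement-of-full-sum π₁ xy S↭xy++R (pair-sum π₁ x₁+y₁))
                (complement-of-full-sum π₂ xy S↭xy++R (pair-sum π₂ x₂+y₂))
    where
      xy = x ∷ y ∷ []
      |R| : length R ≡ m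
      |R| = +-cancelˡ-≡ 2 (length R) m (trans (sym (length-complement xy S↭xy++R)) (trans |S| (+-comm m 2)))
      pair-sum : ∀ f {d} .{{_ : NonZero d}} {c} → (f x + f y) % d ≡ c → sum (map f xy) % d ≡ c
      pair-sum f {d} = trans (cong (_% d) (sum-map-pair f x y))

  Balanced : List E → Set
  Balanced S = Σ₁ S % 2 ≡ 0 × (∀ a → length (layer a S) ≡ suc n)

  pairFree⇒balanced : ∀ {S} → Unique S → length S ≡ m + 2 → PairFree (Σ₁ S) (Σ₂ S) S → Balanced S
  pairFree⇒balanced {S} S! |S| pairFree with m%2≡0⊎m%2≡1 (Σ₁ S)
  ... | inj₂ Σ₁-odd =
    ⊥-elim (m+1+n≰m m (≤-trans (≤-reflexive (sym |S|)) (cross-bound (Σ₁ S) (Σ₂ S) S! Σ₁-odd pairFree)))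
  ... | inj₁ Σ₁-even = Σ₁-even , full
    where
      bound : ∀ a → length (layer a S) ≤ suc n
      bound a = layer-bound a (Σ₁ S) (Σ₂ S) S! Σ₁-even pairFree
      m+2≡[1+n]+[1+n] : ∀ n → 2 * n + 2 ≡ suc n + suc n
      m+2≡[1+n]+[1+n] = solve-∀
      total : length (layer 0F S) + length (layer 1F S) ≡ suc n + suc n
      total = trans (sym (length-layers S)) (trans |S| (m+2≡[1+n]+[1+n] n))
      full : ∀ a → length (layer a S) ≡ suc n
      full 0F = m+n≡o+o⇒m≡o (bound 0F) (bound 1F) total
      full 1F = m+n≡o+o⇒m≡o (bound 1F) (bound 0F) (trans (+-comm (length (layer 1F S)) _) total)

  zeroSumSubset-or-balanced : ∀ {S} → Unique S → length S ≡ m + 2 → ZeroSumSubset S ⊎ Balanced S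
  zeroSumSubset-or-balanced {S} S! |S| with pair-or-pairFree (Σ₁ S) (Σ₂ S) S
  ... | inj₁ (x , y , x∈S , y∈S , x≢y , x+y) = inj₁ (pair-complement S! |S| x∈S y∈S x≢y x+y)
  ... | inj₂ pairFree = inj₂ (pairFree⇒balanced S! |S| pairFree)

  length-layer≤m : ∀ a {S} → Unique S → length (layer a S) ≤ m
  length-layer≤m a {S} S! =
    length-≤-of-key π₂ m (Unique.filter⁺ (λ x → proj₁ x Fin.≟ a) S!) injective (λ {x} _ → toℕ<n (proj₂ x))
    where
      injective : ∀ {x y} → x ∈ layer a S → y ∈ layer a S → π₂ x ≡ π₂ y → x ≡ y
      injective x∈ y∈ x₂≡y₂ =
        cong₂ _,_ (trans (proj₂ (∈-layer⁻ S x∈)) (sym (proj₂ (∈-layer⁻ S y∈)))) (toℕ-injective x₂≡y₂)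

  upper-even : n % 2 ≡ 0 → ∀ {S} → Unique S → length S ≡ m + 2 → ZeroSumSubset S
  upper-even n-even {S} S! |S| with zeroSumSubset-or-balanced S! |S|
  ... | inj₁ found = found
  ... | inj₂ (Σ₁-even , full) = ⊥-elim (1≢0 (begin
    1                 ≡⟨⟩
    (1 + 0) % 2       ≡⟨ cong (λ z → (1 + z) % 2) n-even ⟨
    (1 + n % 2) % 2   ≡⟨ %-absorbʳ-+ {2} 1 n ⟩
    suc n % 2         ≡⟨ cong (_% 2) (trans (sym (full 1F)) (sym (Σ₁≡length-layer₁ S))) ⟩
    Σ₁ S % 2          ≡⟨ Σ₁-even ⟩
    0                 ∎))
    where
      open ≡-Reasoning
      1≢0 : 1 ≢ 0
      1≢0 ()

  thin-layer : ∀ {S} → Unique S → length S ≡ suc (m + 2) →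
    ∃[ a ] (0 < length (layer a S) × length (layer a S) ≤ suc n)
  thin-layer {S} S! |S| = choose (length (layer 0F S) ≤? suc n)
    where
      total : length (layer 0F S) + length (layer 1F S) ≡ suc (m + 2)
      total = trans (sym (length-layers S)) |S|
      positive : ∀ {a} b → b ≤ m → a + b ≡ suc (m + 2) → 0 < a
      positive {zero} b b≤m b≡3+m = ⊥-elim (m+1+n≰m m (≤-trans (≤-reflexive (trans (+-suc m 2) (sym b≡3+m))) b≤m))
      positive {suc a} _ _ _ = s≤s z≤n
      3+m≡[2+n]+[1+n] : ∀ n → suc (2 * n + 2) ≡ suc (suc n) + suc n
      3+m≡[2+n]+[1+n] = solve-∀
      thin₁ : length (layer 0F S) ≰ suc n → length (layer 1F S) ≤ suc n
      thin₁ thick₀ = +-cancelˡ-≤ (suc (suc n)) _ _ (begin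
        suc (suc n) + length (layer 1F S)          ≤⟨ +-monoˡ-≤ _ (≰⇒> thick₀) ⟩
        length (layer 0F S) + length (layer 1F S)  ≡⟨ total ⟩
        suc (m + 2)                                ≡⟨ 3+m≡[2+n]+[1+n] n ⟩
        suc (suc n) + suc n                        ∎)
        where open ≤-Reasoning
      choose : Dec (length (layer 0F S) ≤ suc n) → ∃[ a ] (0 < length (layer a S) × length (layer a S) ≤ suc n)
      choose (yes thin₀) = 0F , positive _ (length-layer≤m 1F S!) total , thin₀
      choose (no thick₀) =
        1F , positive _ (length-layer≤m 0F S!) (trans (+-comm (length (layer 1F S)) _) total) , thin₁ thick₀

  upper-odd : ∀ {S} → Unique S → length S ≡ suc (m + 2) → ZeroSumSubset S
  upper-odd {S} S! |S| with thin-layer S! |S|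
  ... | a , nonempty , thin with nonempty-∈ nonempty
  ... | z , z∈layer with ∈-layer⁻ S z∈layer
  ... | z∈S , z₁≡a with ⊆-complement (z ∷ []) ([] ∷ []) (z∈S ∷ [])
  ... | R , S↭z∷R with zeroSumSubset-or-balanced (complement-unique (z ∷ []) S↭z∷R S!) |R|
    where
      |R| : length R ≡ m + 2
      |R| = suc-injective (trans (sym (length-complement (z ∷ []) S↭z∷R)) |S|)
  ... | inj₁ found = HasZeroSumSubset-mono G m (complement-⊆ (z ∷ []) S↭z∷R) found
  ... | inj₂ (_ , full) = ⊥-elim (1+n≰n (begin
    suc (suc n)                     ≡⟨ cong suc (full a) ⟨
    suc (length (layer a R))        ≡⟨ length-layer-∷ z R z₁≡a ⟨
    length (layer a (z ∷ R))        ≡⟨ length-layer-↭ a S↭z∷R ⟨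
    length (layer a S)              ≤⟨ thin ⟩
    suc n                           ∎))
    where open ≤-Reasoning

  -- Extremal sets

  triangle : ℕ → ℕ
  triangle N = sum (downFrom N)

  triangle-double : ∀ N → triangle N * 2 + N ≡ N * N
  triangle-double zero = refl
  triangle-double (suc N) = begin
    (N + triangle N) * 2 + suc N        ≡⟨ regroup N (triangle N) ⟩
    (triangle N * 2 + N) + (N + N + 1)  ≡⟨ cong (_+ (N + N + 1)) (triangle-double N) ⟩
    N * N + (N + N + 1)                 ≡⟨ square N ⟩
    suc N * suc N                       ∎
    where
      open ≡-Reasoning
      regroup : ∀ N t → (N + t) * 2 + suc N ≡ (t * 2 + N) + (N + N + 1)
      regroup = solve-∀
      square : ∀ N → N * N + (N + N + 1) ≡ suc N * suc N
      square = solve-∀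

  row : Fin 2 → ℕ → List E
  row a N = map (λ i → a , i mod m) (downFrom N)

  length-row : ∀ a N → length (row a N) ≡ N
  length-row a N = trans (length-map _ (downFrom N)) (length-downFrom N)

  module _ {N : ℕ} (N≤m : N ≤ m) where

    toℕ-mod-downFrom : ∀ {i} → i ∈ downFrom N → toℕ (i mod m) ≡ i
    toℕ-mod-downFrom {i} i∈ = trans (toℕ-mod i) (m<n⇒m%n≡m (≤-trans (∈-downFrom⁻ i∈) N≤m))

    row-unique : ∀ a → Unique (row a N)
    row-unique a = Unique-map⁺-on _ (Unique.downFrom⁺ N) (λ i∈ j∈ ai≡aj →
      trans (sym (toℕ-mod-downFrom i∈)) (trans (cong (toℕ ∘ proj₂) ai≡aj) (toℕ-mod-downFrom j∈)))

    ∈-row⁻ : ∀ a {x} → x ∈ row a N → proj₁ x ≡ a × π₂ x < N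
    ∈-row⁻ a x∈ with ∈-map⁻ _ x∈
    ... | i , i∈ , refl = refl , subst (_< N) (sym (toℕ-mod-downFrom i∈)) (∈-downFrom⁻ i∈)

  Σ₁-row : ∀ a N → Σ₁ (row a N) ≡ N * toℕ a
  Σ₁-row a zero = refl
  Σ₁-row a (suc N) = cong (toℕ a +_) (Σ₁-row a N)

  Σ₂-row : ∀ a {N} → N ≤ m → Σ₂ (row a N) ≡ triangle N
  Σ₂-row a {zero} _ = refl
  Σ₂-row a {suc N} 1+N≤m = cong₂ _+_ (toℕ-mod-downFrom 1+N≤m (here refl)) (Σ₂-row a (≤-trans (n≤1+n N) 1+N≤m))

  evenWitness : List E
  evenWitness = (1F , 0F) ∷ row 0F m

  evenWitness-unique : Unique evenWitness
  evenWitness-unique =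
    All.tabulate (λ x∈row 1F≡x → 1F≢0F (trans (cong proj₁ 1F≡x) (proj₁ (∈-row⁻ ≤-refl 0F x∈row))))
    ∷ row-unique ≤-refl 0F
    where
      1F≢0F : 1F ≢ 0F
      1F≢0F ()

  length-evenWitness : length evenWitness ≡ m + 1
  length-evenWitness = trans (cong suc (length-row 0F m)) (+-comm 1 m)

  triangle-m+n : triangle m + n ≡ n * m
  triangle-m+n = *-cancelʳ-≡ (triangle m + n) (n * m) 2 (begin
    (triangle m + n) * 2     ≡⟨ distrib (triangle m) n ⟩
    triangle m * 2 + m       ≡⟨ triangle-double m ⟩
    m * m                    ≡⟨ regroup n ⟩
    n * m * 2                ∎)
    where
      open ≡-Reasoning
      distrib : ∀ t n → (t + n) * 2 ≡ t * 2 + 2 * n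
      distrib = solve-∀
      regroup : ∀ n → (2 * n) * (2 * n) ≡ n * (2 * n) * 2
      regroup = solve-∀

  evenWitness-free : ¬ ZeroSumSubset evenWitness
  evenWitness-free (T , T! , T⊆W , |T| , ΣT≡𝟘) with ⊆-complement T T! T⊆W
  ... | R , W↭T++R = one-left R (complement-⊆ T W↭T++R) |R|
      (complement-of-zero-sum π₁ T W↭T++R (proj₁ (sumG≡𝟘⇒ T ΣT≡𝟘)))
      (complement-of-zero-sum π₂ T W↭T++R (proj₂ (sumG≡𝟘⇒ T ΣT≡𝟘)))
    where
      |R| : length R ≡ 1
      |R| = +-cancelˡ-≡ m (length R) 1
        (trans (cong (_+ length R) (sym |T|)) (trans (sym (length-complement T W↭T++R)) length-evenWitness))
      one-left : ∀ R → All (_∈ evenWitness) R → length R ≡ 1 →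
        Σ₁ R % 2 ≡ Σ₁ evenWitness % 2 → Σ₂ R % m ≡ Σ₂ evenWitness % m → ⊥
      one-left (_ ∷ []) (here refl ∷ []) _ _ Σ₂R≡Σ₂W = n≢0 (begin
        n                         ≡⟨ m<n⇒m%n≡m n<m ⟨
        n % m                     ≡⟨ %-congˡ-+ 0 (triangle m) n (trans Σ₂R≡Σ₂W (cong (_% m) (Σ₂-row 0F ≤-refl))) ⟩
        (triangle m + n) % m      ≡⟨ cong (_% m) triangle-m+n ⟩
        (n * m) % m               ≡⟨ m*n%n≡0 n m ⟩
        0                         ∎)
        where
          open ≡-Reasoning
          n≢0 : n ≢ 0
          n≢0 ()
      one-left (r ∷ []) (there r∈row ∷ []) _ Σ₁R≡Σ₁W _ = 0≢1 (begin
        0                          ≡⟨ cong (λ z → (toℕ z + 0) % 2) (proj₁ (∈-row⁻ ≤-refl 0F r∈row)) ⟨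
        Σ₁ (r ∷ []) % 2            ≡⟨ Σ₁R≡Σ₁W ⟩
        (1 + Σ₁ (row 0F m)) % 2    ≡⟨ cong (λ z → (1 + z) % 2) (trans (Σ₁-row 0F m) (*-zeroʳ m)) ⟩
        1                          ∎)
        where
          open ≡-Reasoning
          0≢1 : 0 ≢ 1
          0≢1 ()

  oddWitness : List E
  oddWitness = row 0F (suc n) ++ row 1F (suc n)

  oddWitness-unique : Unique oddWitness
  oddWitness-unique = Unique.++⁺ (row-unique n<m 0F) (row-unique n<m 1F)
    (λ (x∈row₀ , x∈row₁) →
      0F≢1F (trans (sym (proj₁ (∈-row⁻ n<m 0F x∈row₀))) (proj₁ (∈-row⁻ n<m 1F x∈row₁))))
    where
      0F≢1F : 0F ≢ 1F
      0F≢1F ()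

  length-oddWitness : length oddWitness ≡ m + 2
  length-oddWitness = trans (length-++ (row 0F (suc n)))
    (trans (cong₂ _+_ (length-row 0F (suc n)) (length-row 1F (suc n))) ([1+n]+[1+n]≡2n+2 n))
    where
      [1+n]+[1+n]≡2n+2 : ∀ n → suc n + suc n ≡ 2 * n + 2
      [1+n]+[1+n]≡2n+2 = solve-∀

  ∈-oddWitness⁻ : ∀ {x} → x ∈ oddWitness → π₂ x ≤ n
  ∈-oddWitness⁻ x∈ with ∈-++⁻ (row 0F (suc n)) x∈
  ... | inj₁ x∈row₀ = s≤s⁻¹ (proj₂ (∈-row⁻ n<m 0F x∈row₀))
  ... | inj₂ x∈row₁ = s≤s⁻¹ (proj₂ (∈-row⁻ n<m 1F x∈row₁))

  ≤n⇒+%m≡0⇒≡ : ∀ {i j} → i ≤ n → j ≤ n → (i + j) % m ≡ 0 → i ≡ j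
  ≤n⇒+%m≡0⇒≡ {i} {j} i≤n j≤n i+j≡0 with i + j <? m
  ... | yes i+j<m = trans (m+n≡0⇒m≡0 i i+j≡0′) (sym (m+n≡0⇒n≡0 i i+j≡0′))
    where
      i+j≡0′ : i + j ≡ 0
      i+j≡0′ = trans (sym (m<n⇒m%n≡m i+j<m)) i+j≡0
  ... | no i+j≮m =
    trans (m+n≡o+o⇒m≡o i≤n j≤n i+j≡n+n) (sym (m+n≡o+o⇒m≡o j≤n i≤n (trans (+-comm j i) i+j≡n+n)))
    where
      i+j≡n+n : i + j ≡ n + n
      i+j≡n+n = ≤-antisym (+-mono-≤ i≤n j≤n)
        (≤-trans (≤-reflexive (cong (n +_) (sym (+-identityʳ n)))) (≮⇒≥ i+j≮m))

  module _ (n-odd : n % 2 ≡ 1) where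
    private
      j : ℕ
      j = n / 2
      n≡1+2j : n ≡ 1 + j * 2
      n≡1+2j = trans (m≡m%n+[m/n]*n n 2) (cong (_+ j * 2) n-odd)

    Σ₁-oddWitness : Σ₁ oddWitness % 2 ≡ 0
    Σ₁-oddWitness = begin
      Σ₁ oddWitness % 2                                ≡⟨ cong (_% 2) (sum-map-++ π₁ (row 0F (suc n)) _) ⟩
      (Σ₁ (row 0F (suc n)) + Σ₁ (row 1F (suc n))) % 2  ≡⟨ cong₂ (λ a b → (a + b) % 2) (Σ₁-row 0F (suc n)) (Σ₁-row 1F (suc n)) ⟩
      (suc n * 0 + suc n * 1) % 2                      ≡⟨ cong (_% 2) (trans (one-row n) (cong suc n≡1+2j)) ⟩
      (2 + j * 2) % 2                                  ≡⟨ m*n%n≡0 (suc j) 2 ⟩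
      0                                                ∎
      where
        open ≡-Reasoning
        one-row : ∀ n → suc n * 0 + suc n * 1 ≡ suc n
        one-row = solve-∀

    Σ₂-oddWitness : Σ₂ oddWitness % m ≡ 0
    Σ₂-oddWitness = begin
      Σ₂ oddWitness % m                                ≡⟨ cong (_% m) (sum-map-++ π₂ (row 0F (suc n)) _) ⟩
      (Σ₂ (row 0F (suc n)) + Σ₂ (row 1F (suc n))) % m  ≡⟨ cong₂ (λ a b → (a + b) % m) (Σ₂-row 0F n<m) (Σ₂-row 1F n<m) ⟩
      (triangle (suc n) + triangle (suc n)) % m        ≡⟨ cong (_% m) (trans (t+t≡t*2 (triangle (suc n))) triangle[1+n]*2) ⟩
      (n * suc n) % m                                  ≡⟨ cong (λ z → (n * suc z) % m) n≡1+2j ⟩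
      (n * (2 + j * 2)) % m                            ≡⟨ cong (_% m) (regroup n j) ⟩
      (suc j * m) % m                                  ≡⟨ m*n%n≡0 (suc j) m ⟩
      0                                                ∎
      where
        open ≡-Reasoning
        t+t≡t*2 : ∀ t → t + t ≡ t * 2
        t+t≡t*2 = solve-∀
        square-split : ∀ n → suc n * suc n ≡ n * suc n + suc n
        square-split = solve-∀
        regroup : ∀ n j → n * (2 + j * 2) ≡ suc j * (2 * n)
        regroup = solve-∀
        triangle[1+n]*2 : triangle (suc n) * 2 ≡ n * suc n
        triangle[1+n]*2 = +-cancelʳ-≡ (suc n) _ _ (trans (triangle-double (suc n)) (square-split n))

    oddWitness-free : ¬ ZeroSumSubset oddWitness
    oddWitness-free (T , T! , T⊆W , |T| , ΣT≡𝟘) with ⊆-complement T T! T⊆W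
    ... | R , W↭T++R = two-left R (complement-⊆ T W↭T++R) (complement-unique T W↭T++R oddWitness-unique) |R|
        (trans (complement-of-zero-sum π₁ T W↭T++R (proj₁ (sumG≡𝟘⇒ T ΣT≡𝟘))) Σ₁-oddWitness)
        (trans (complement-of-zero-sum π₂ T W↭T++R (proj₂ (sumG≡𝟘⇒ T ΣT≡𝟘))) Σ₂-oddWitness)
      where
        |R| : length R ≡ 2
        |R| = +-cancelˡ-≡ m (length R) 2
          (trans (cong (_+ length R) (sym |T|)) (trans (sym (length-complement T W↭T++R)) length-oddWitness))
        same-layer : ∀ (a b : Fin 2) → (toℕ a + toℕ b) % 2 ≡ 0 → a ≡ b
        same-layer 0F 0F _ = refl
        same-layer 1F 1F _ = refl
        same-layer 0F 1F ()
        same-layer 1F 0F ()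
        two-left : ∀ R → All (_∈ oddWitness) R → Unique R → length R ≡ 2 →
          Σ₁ R % 2 ≡ 0 → Σ₂ R % m ≡ 0 → ⊥
        two-left (x ∷ y ∷ []) (x∈W ∷ y∈W ∷ []) ((x≢y ∷ []) ∷ _) _ Σ₁R≡0 Σ₂R≡0 = x≢y (cong₂ _,_
          (same-layer (proj₁ x) (proj₁ y) (trans (cong (_% 2) (sym (sum-map-pair π₁ x y))) Σ₁R≡0))
          (toℕ-injective (≤n⇒+%m≡0⇒≡ (∈-oddWitness⁻ x∈W) (∈-oddWitness⁻ y∈W)
            (trans (cong (_% m) (sym (sum-map-pair π₂ x y))) Σ₂R≡0))))

theorem1p1 : (n : ℕ) .{{_ : NonZero n}} → (e : ℕ) → IsExponent (C2⊕C2n n) e →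
    ((n % 2 ≡ 1 → IsHarborthConstant (C2⊕C2n n) e (2 * n + 3))
     × (n % 2 ≡ 0 → IsHarborthConstant (C2⊕C2n n) e (2 * n + 2)))
theorem1p1 zero {{()}}
theorem1p1 (suc k) e exponent with C₂⊕C₂ₙ.exponent≡m k exponent
... | refl = odd , even
  where
    open C₂⊕C₂ₙ k
    odd : n % 2 ≡ 1 → IsHarborthConstant G m (m + 3)
    odd n-odd = IsHarborthConstant-intro G m (m + 2) (+-suc m 2)
      (λ S! |S| → upper-odd S! (trans |S| (+-suc m 2)))
      oddWitness oddWitness-unique length-oddWitness (oddWitness-free n-odd)
    even : n % 2 ≡ 0 → IsHarborthConstant G m (m + 2)
    even n-even = IsHarborthConstant-intro G m (m + 1) (+-suc m 1)
      (upper-even n-even)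
      evenWitness evenWitness-unique length-evenWitness evenWitness-free
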